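{- Let $k\ge2$, $\sigma\in\{+,-\}^k$, $n\ge1$ and $\pi=\pi_1\cdots\pi_n\in\mathfrak S_n$. If $\pi\in\mathcal A_n(\Sigma_\sigma)$, then $\pi$ satisfies condition $(\dagger)$: there exists a $*$-$\sigma$-segmentation $0=e_0\le e_1\le\cdots\le e_k=n$ of $\hat\pi^*$ such that there is no integer $b\ge1$ with $n-2b\ge1$ for which both $\rho(\pi_{n-2b},\pi_{n-b},\pi_n)\in\{312,132\}$ and, for all $1\le i\le b$ and all $0\le t\le k-1$, $e_t<\pi_{n-b-i}\le e_{t+1}$ if and only if $e_t<\pi_{n-i}\le e_{t+1}$.
   Context: Fix $k\ge2$ and $\sigma=\sigma_0\cdots\sigma_{k-1}\in\{+,-\}^k$; $T^-_\sigma=\{t:\sigma_t=-\}$. $\mathcal W_k$ is the set of infinite words $s_1s_2\cdots$ over $\{0,\dots,k-1\}$. Order $\prec_\sigma$: for $s\ne t$, with $j$ minimal such that $s_j\ne t_j$ and $c=|\{1\le i<j:s_i\in T^-_\sigma\}|$, $s\prec_\sigma t$ iff ($c$ even and $s_j<t_j$) or ($c$ odd and $s_j>t_j$). $\Sigma_\sigma(s_1s_2\cdots)=s_2s_3\cdots$. $\rho(x_1,\dots,x_n)$ is the permutation of $[n]$ in the same relative order as the distinct $x_i$. $\mathrm{Pat}(s,\Sigma_\sigma,n)=\rho(s,\Sigma_\sigma(s),\dots,\Sigma_\sigma^{n-1}(s))$ (w.r.t. $\prec_\sigma$) when these $n$ words are distinct, undefined otherwise; $\mathcal A_n(\Sigma_\sigma)$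 is the set of defined such patterns. For $\pi\in\mathfrak S_n$, $\hat\pi$ is given by $\hat\pi_{\pi_i}=\pi_{i+1}$ ($\pi_{n+1}:=\pi_1$), and $\hat\pi^*$ is the one-line word of $\hat\pi$ with the entry equal to $\pi_1$ replaced by $*$. A $*$-$\sigma$-segmentation of $\tau^*=\tau^*_1\cdots\tau^*_n$ is $0=e_0\le\cdots\le e_k=n$ with: (a) for each $t$, the non-$*$ entries of $\tau^*_{e_t+1}\cdots\tau^*_{e_{t+1}}$ are increasing if $\sigma_t=+$, decreasing if $\sigma_t=-$; (b) if $\sigma_0=+$ and $\tau^*_1\tau^*_2=*1$ then $e_1\le1$; (c) if $\sigma_{k-1}=+$ and $\tau^*_{n-1}\tau^*_n=n*$ then $e_{k-1}\ge n-1$; (d) if $\sigma_0=\sigma_{k-1}=-$, $\tau^*_1=n$ and $\tau^*_{n-1}\tau^*_n=1*$ then $e_1=0$ or $e_{k-1}\ge n-1$; (e) if $\sigma_0=\sigma_{k-1}=-$, $\tau^*_n=1$ and $\tau^*_1\tau^*_2=*n$ then $e_{k-1}=n$ or $e_1\le1$. -}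

module Defs where

open import Data.Nat using (ℕ; zero; suc; _+_; _*_; _∸_; _≤_; _<_; _%_; NonZero)
open import Data.Nat.Properties using (_<?_)
open import Data.Nat.DivMod using (_mod_)
open import Data.Fin as F using (Fin; toℕ; fromℕ<)
open import Data.Fin.Permutation using (Permutation′; _⟨$⟩ʳ_; _⟨$⟩ˡ_)
open import Data.Maybe using (Maybe; just; nothing)
open import Data.Product using (Σ; _×_; _,_)
open import Data.Sum using (_⊎_)
open import Relation.Binary.PropositionalEquality using (_≡_; _≢_)
open import Relation.Nullary using (¬_; yes; no)
open import Data.Nat using (_≟_)
open import Function.Bundles using (_⇔_)

data Sign : Set where
  plus minus : Sign

-- Infinite words over {0,...,k-1}, indexed from 0 (s 0 = s_1 of the paper).
Word : ℕ → Set
Word k = ℕ → Fin k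

shift : ∀ {k} → ℕ → Word k → Word k
shift m s i = s (m + i)

SameWord : ∀ {k} → Word k → Word k → Set
SameWord s t = ∀ i → s i ≡ t i

negCount : ∀ {k} → (Fin k → Sign) → Word k → ℕ → ℕ
negCount σ s zero = 0
negCount σ s (suc j) with σ (s j)
... | plus  = negCount σ s j
... | minus = suc (negCount σ s j)

_≺[_]_ : ∀ {k} → Word k → (Fin k → Sign) → Word k → Set
s ≺[ σ ] t = Σ ℕ λ j → (∀ i → i < j → s i ≡ t i) ×
  ((negCount σ s j % 2 ≡ 0 × s j F.< t j) ⊎ (negCount σ s j % 2 ≡ 1 × t j F.< s j))

-- Pat(s, Σ_σ, n) is defined and equals π (π given as a bijection of Fin n,
-- position i ↦ value, both 0-indexed).
IsPattern : ∀ {k n} → (Fin k → Sign) → Word k → Permutation′ n → Set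
IsPattern {n = n} σ s π =
  (∀ (i j : Fin n) → i ≢ j → ¬ SameWord (shift (toℕ i) s) (shift (toℕ j) s)) ×
  (∀ (i j : Fin n) → (π ⟨$⟩ʳ i F.< π ⟨$⟩ʳ j) ⇔ (shift (toℕ i) s ≺[ σ ] shift (toℕ j) s))

Allowed : ∀ {k n} → (Fin k → Sign) → Permutation′ n → Set
Allowed {k} σ π = Σ (Word k) λ s → IsPattern σ s π

-- π_i with 1-indexed positions and values (0 outside 1 ≤ i ≤ n)
piN : ∀ {n} → Permutation′ n → ℕ → ℕ
piN π zero = 0
piN {n} π (suc i) with i <? n
... | yes p = suc (toℕ (π ⟨$⟩ʳ fromℕ< p))
... | no _  = 0

nextFin : ∀ {n} → Fin n → Fin n
nextFin {suc m} i = suc (toℕ i) mod (suc m)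

-- π̂^* as a word indexed by positions 1..n (1-indexed values; nothing = *;
-- positions outside 1..n give nothing and are never used as entries).
-- π̂_{π_i} = π_{i+1}; the entry equal to π_1 is replaced by *.
hatStar : ∀ {n} → Permutation′ n → ℕ → Maybe ℕ
hatStar π zero = nothing
hatStar {n} π (suc p) with p <? n
... | no _ = nothing
... | yes lt with toℕ (nextFin (π ⟨$⟩ˡ fromℕ< lt)) ≟ 0
...   | yes _ = nothing
...   | no _  = just (suc (toℕ (π ⟨$⟩ʳ nextFin (π ⟨$⟩ˡ fromℕ< lt))))

record IsSegmentation {k : ℕ} (σ : Fin k → Sign) (n : ℕ) (τ : ℕ → Maybe ℕ) (e : ℕ → ℕ) : Set where
  field
    start : e 0 ≡ 0
    end   : e k ≡ n
    mono  : ∀ t → t < k → e t ≤ e (suc t)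
    blocks : ∀ (t : Fin k) (p q a b : ℕ) → e (toℕ t) < p → p < q → q ≤ e (suc (toℕ t)) →
             τ p ≡ just a → τ q ≡ just b →
             (σ t ≡ plus → a < b) × (σ t ≡ minus → b < a)
    condB : ∀ (t0 : Fin k) → toℕ t0 ≡ 0 → σ t0 ≡ plus →
            τ 1 ≡ nothing → τ 2 ≡ just 1 → e 1 ≤ 1
    condC : ∀ (tl : Fin k) → suc (toℕ tl) ≡ k → σ tl ≡ plus →
            τ (n ∸ 1) ≡ just n → τ n ≡ nothing → n ∸ 1 ≤ e (k ∸ 1)
    condD : ∀ (t0 tl : Fin k) → toℕ t0 ≡ 0 → suc (toℕ tl) ≡ k →
            σ t0 ≡ minus → σ tl ≡ minus →
            τ 1 ≡ just n → τ (n ∸ 1) ≡ just 1 → τ n ≡ nothing →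
            e 1 ≡ 0 ⊎ n ∸ 1 ≤ e (k ∸ 1)
    condE : ∀ (t0 tl : Fin k) → toℕ t0 ≡ 0 → suc (toℕ tl) ≡ k →
            σ t0 ≡ minus → σ tl ≡ minus →
            τ n ≡ just 1 → τ 1 ≡ nothing → τ 2 ≡ just n →
            e (k ∸ 1) ≡ n ⊎ e 1 ≤ 1

Is312 Is132 : ℕ → ℕ → ℕ → Set
Is312 x y z = y < z × z < x
Is132 x y z = x < z × z < y

InBlock : (ℕ → ℕ) → ℕ → ℕ → Set
InBlock e t x = e t < x × x ≤ e (suc t)

Dagger : ∀ {k n} → (Fin k → Sign) → Permutation′ n → Set
Dagger {k} {n} σ π = Σ (ℕ → ℕ) λ e → IsSegmentation σ n (hatStar π) e ×
  ¬ (Σ ℕ λ b → 1 ≤ b × 1 ≤ n ∸ 2 * b ×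
       (Is312 (piN π (n ∸ 2 * b)) (piN π (n ∸ b)) (piN π n) ⊎
        Is132 (piN π (n ∸ 2 * b)) (piN π (n ∸ b)) (piN π n)) ×
       (∀ i → 1 ≤ i → i ≤ b → ∀ (t : Fin k) →
          InBlock e (toℕ t) (piN π (n ∸ b ∸ i)) ⇔ InBlock e (toℕ t) (piN π (n ∸ i))))

module Submission where

-- Fix a word s whose shifts s, Σs, …, Σ^{n-1}s realise π under ≺σ.  Since ≺σ
-- compares first letters first, the first letter g v of the orbit word of
-- rank v is monotone in v, so e_t = #{v < n : g v < t} cuts the values 1..n
-- into blocks, block t holding the values π_{i+1} with s_i = t.

open import Defs
open import Data.Nat using (ℕ; zero; suc; _+_; _*_; _∸_; _≤_; _<_; _%_; z≤n; s≤s; s≤s⁻¹; z<s; _≟_)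
open import Data.Nat.Properties
open import Data.Nat.DivMod using ([m+n]%n≡m%n; m<n⇒m%n≡m; n%n≡0)
open import Data.Nat.Tactic.RingSolver using (solve-∀)
open import Data.Fin as F using (Fin; toℕ; fromℕ<)
open import Data.Fin.Properties using (toℕ-injective; fromℕ<-toℕ; toℕ-fromℕ<; toℕ<n)
open import Data.Fin.Permutation using (Permutation′; _⟨$⟩ʳ_; _⟨$⟩ˡ_; inverseʳ; inverseˡ)
open import Data.Maybe using (just; nothing)
open import Data.Product using (Σ; _×_; _,_; proj₁; proj₂)
open import Data.Sum using (_⊎_; inj₁; inj₂)
open import Data.Empty using (⊥; ⊥-elim)
open import Relation.Binary.PropositionalEquality
open import Relation.Nullary using (¬_; yes; no; Dec)
open import Function.Bundles using (_⇔_; Equivalence)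

%2-suc-suc : ∀ c → suc (suc c) % 2 ≡ c % 2
%2-suc-suc c = trans (cong (_% 2) (+-comm 2 c)) ([m+n]%n≡m%n c 2)

suc-even⇒odd : ∀ c → suc c % 2 ≡ 0 → c % 2 ≡ 1
suc-even⇒odd zero ()
suc-even⇒odd (suc zero) _ = refl
suc-even⇒odd (suc (suc c)) h =
  trans (%2-suc-suc c) (suc-even⇒odd c (trans (sym (%2-suc-suc (suc c))) h))

suc-odd⇒even : ∀ c → suc c % 2 ≡ 1 → c % 2 ≡ 0
suc-odd⇒even zero _ = refl
suc-odd⇒even (suc zero) ()
suc-odd⇒even (suc (suc c)) h =
  trans (%2-suc-suc c) (suc-odd⇒even c (trans (sym (%2-suc-suc (suc c))) h))

bump : Sign → ℕ → ℕ
bump plus c = c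
bump minus c = suc c

bump-comm : ∀ a b c → bump a (bump b c) ≡ bump b (bump a c)
bump-comm plus plus c = refl
bump-comm plus minus c = refl
bump-comm minus plus c = refl
bump-comm minus minus c = refl

module Order {k : ℕ} (σ : Fin k → Sign) where

  _≺_ : Word k → Word k → Set
  x ≺ y = x ≺[ σ ] y

  Decided : Word k → Word k → ℕ → Set
  Decided x y j = (negCount σ x j % 2 ≡ 0 × x j F.< y j) ⊎ (negCount σ x j % 2 ≡ 1 × y j F.< x j)

  tl : Word k → Word k
  tl x i = x (suc i)

  negCount-suc : ∀ (x : Word k) j → negCount σ x (suc j) ≡ bump (σ (x j)) (negCount σ x j)
  negCount-suc x j with σ (x j)
  ... | plus = refl
  ... | minus = refl

  negCount-tl : ∀ (x : Word k) j → negCount σ x (suc j) ≡ bump (σ (x 0)) (negCount σ (tl x) j)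
  negCount-tl x zero = negCount-suc x 0
  negCount-tl x (suc j) = begin
    negCount σ x (suc (suc j))
      ≡⟨ negCount-suc x (suc j) ⟩
    bump (σ (x (suc j))) (negCount σ x (suc j))
      ≡⟨ cong (bump (σ (x (suc j)))) (negCount-tl x j) ⟩
    bump (σ (x (suc j))) (bump (σ (x 0)) (negCount σ (tl x) j))
      ≡⟨ bump-comm (σ (x (suc j))) (σ (x 0)) _ ⟩
    bump (σ (x 0)) (bump (σ (x (suc j))) (negCount σ (tl x) j))
      ≡⟨ cong (bump (σ (x 0))) (sym (negCount-suc (tl x) j)) ⟩
    bump (σ (x 0)) (negCount σ (tl x) (suc j)) ∎
    where open ≡-Reasoning

  negCount-cong : ∀ (x y : Word k) j → (∀ i → i < j → x i ≡ y i) → negCount σ x j ≡ negCount σ y j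
  negCount-cong x y zero h = refl
  negCount-cong x y (suc j) h = begin
    negCount σ x (suc j)                  ≡⟨ negCount-suc x j ⟩
    bump (σ (x j)) (negCount σ x j)        ≡⟨ cong₂ (λ a c → bump (σ a) c) (h j ≤-refl) ih ⟩
    bump (σ (y j)) (negCount σ y j)        ≡⟨ negCount-suc y j ⟨
    negCount σ y (suc j)                  ∎
    where
    open ≡-Reasoning
    ih : negCount σ x j ≡ negCount σ y j
    ih = negCount-cong x y j (λ i i<j → h i (m<n⇒m<1+n i<j))

  ≺-transferˡ : ∀ {x y z : Word k} (o : y ≺ z) → (∀ i → i ≤ proj₁ o → x i ≡ y i) → x ≺ z
  ≺-transferˡ {x} {y} {z} (j , ag , o) h = j , (λ i i<j → trans (h i (<⇒≤ i<j)) (ag i i<j)) , decide o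
    where
    count : negCount σ x j % 2 ≡ negCount σ y j % 2
    count = cong (_% 2) (negCount-cong x y j (λ i i<j → h i (<⇒≤ i<j)))
    decide : Decided y z j → Decided x z j
    decide (inj₁ (a , b)) = inj₁ (trans count a , subst (λ c → toℕ c < _) (sym (h j ≤-refl)) b)
    decide (inj₂ (a , b)) = inj₂ (trans count a , subst (λ c → _ < toℕ c) (sym (h j ≤-refl)) b)

  ≺-transferʳ : ∀ {x y z : Word k} (o : z ≺ y) → (∀ i → i ≤ proj₁ o → x i ≡ y i) → z ≺ x
  ≺-transferʳ {x} {y} {z} (j , ag , o) h = j , (λ i i<j → trans (ag i i<j) (sym (h i (<⇒≤ i<j)))) , decide o
    where
    decide : Decided z y j → Decided z x j
    decide (inj₁ (a , b)) = inj₁ (a , subst (λ c → _ < toℕ c) (sym (h j ≤-refl)) b)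
    decide (inj₂ (a , b)) = inj₂ (a , subst (λ c → toℕ c < _) (sym (h j ≤-refl)) b)

  ≺-resp : ∀ {x x' y y' : Word k} → SameWord x x' → SameWord y y' → x ≺ y → x' ≺ y'
  ≺-resp ex ey o =
    ≺-transferʳ (≺-transferˡ o (λ i _ → sym (ex i))) (λ i _ → sym (ey i))

  ≺-irrefl : ∀ {x y : Word k} → SameWord x y → ¬ (x ≺ y)
  ≺-irrefl e (j , _ , inj₁ (_ , q)) = <-irrefl (cong toℕ (e j)) q
  ≺-irrefl e (j , _ , inj₂ (_ , q)) = <-irrefl (cong toℕ (sym (e j))) q

  first<⇒≺ : ∀ (x y : Word k) → toℕ (x 0) < toℕ (y 0) → x ≺ y
  first<⇒≺ x y h = 0 , (λ i ()) , inj₁ (refl , h)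

  ≺⇒first≤ : ∀ {x y : Word k} → x ≺ y → toℕ (x 0) ≤ toℕ (y 0)
  ≺⇒first≤ (zero , ag , inj₁ (_ , q)) = <⇒≤ q
  ≺⇒first≤ (zero , ag , inj₂ (() , _))
  ≺⇒first≤ (suc j , ag , _) = ≤-reflexive (cong toℕ (ag 0 z<s))

  tl-plus : ∀ {x y : Word k} → x ≺ y → x 0 ≡ y 0 → σ (x 0) ≡ plus → tl x ≺ tl y
  tl-plus (zero , _ , inj₁ (_ , q)) e _ = ⊥-elim (<-irrefl (cong toℕ e) q)
  tl-plus (zero , _ , inj₂ (() , _)) e _
  tl-plus {x} {y} (suc j , ag , o) e p = j , (λ i i<j → ag (suc i) (s≤s i<j)) , decide o
    where
    count : negCount σ (tl x) j % 2 ≡ negCount σ x (suc j) % 2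
    count = cong (_% 2) (sym (trans (negCount-tl x j) (cong (λ a → bump a (negCount σ (tl x) j)) p)))
    decide : Decided x y (suc j) → Decided (tl x) (tl y) j
    decide (inj₁ (a , b)) = inj₁ (trans count a , b)
    decide (inj₂ (a , b)) = inj₂ (trans count a , b)

  tl-minus : ∀ {x y : Word k} → x ≺ y → x 0 ≡ y 0 → σ (x 0) ≡ minus → tl y ≺ tl x
  tl-minus (zero , _ , inj₁ (_ , q)) e _ = ⊥-elim (<-irrefl (cong toℕ e) q)
  tl-minus (zero , _ , inj₂ (() , _)) e _
  tl-minus {x} {y} (suc j , ag , o) e p = j , (λ i i<j → sym (ag (suc i) (s≤s i<j))) , decide o
    where
    shifted : negCount σ x (suc j) ≡ suc (negCount σ (tl y) j)
    shifted = trans (negCount-tl x j) (trans (cong (λ a → bump a (negCount σ (tl x) j)) p)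
                (cong suc (negCount-cong (tl x) (tl y) j (λ i i<j → ag (suc i) (s≤s i<j)))))
    count : suc (negCount σ (tl y) j) % 2 ≡ negCount σ x (suc j) % 2
    count = cong (_% 2) (sym shifted)
    decide : Decided x y (suc j) → Decided (tl y) (tl x) j
    decide (inj₁ (a , b)) = inj₂ (suc-even⇒odd (negCount σ (tl y) j) (trans count a) , b)
    decide (inj₂ (a , b)) = inj₁ (suc-odd⇒even (negCount σ (tl y) j) (trans count a) , b)

IsMin IsMax : ∀ {k} → Fin k → Set
IsMin {k} a = ∀ (c : Fin k) → toℕ c ≤ toℕ a → c ≡ a
IsMax {k} a = ∀ (c : Fin k) → toℕ a ≤ toℕ c → c ≡ a

zero-isMin : ∀ {k} (a : Fin k) → toℕ a ≡ 0 → IsMin a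
zero-isMin a z c h = toℕ-injective (trans (n≤0⇒n≡0 (subst (toℕ c ≤_) z h)) (sym z))

last-isMax : ∀ {k} (a : Fin k) → suc (toℕ a) ≡ k → IsMax a
last-isMax {k} a z c h = toℕ-injective (≤-antisym (s≤s⁻¹ (subst (toℕ c <_) (sym z) (toℕ<n c))) h)

-- An orbit becomes
-- periodic as soon as an invariant forcing s j ≡ s (d + j) is preserved by
-- the shift; then two orbit words coincide and cannot be strictly compared.
-- This rules out the configurations behind conditions (b)-(e).
module Orbit {k : ℕ} (σ : Fin k → Sign) (s : Word k) where
  open Order σ

  Wd : ℕ → Word k
  Wd j = shift j s

  Wd-head : ∀ j → Wd j 0 ≡ s j
  Wd-head j = cong s (+-identityʳ j)

  L : ℕ → ℕ
  L i = toℕ (s i)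

  Wd-tl : ∀ j → SameWord (tl (Wd j)) (Wd (suc j))
  Wd-tl j i = cong s (+-suc j i)

  L<⇒≺ : ∀ i j → L i < L j → Wd i ≺ Wd j
  L<⇒≺ i j h = first<⇒≺ (Wd i) (Wd j) (subst₂ _<_ (cong toℕ (sym (Wd-head i))) (cong toℕ (sym (Wd-head j))) h)

  ≺⇒L≤ : ∀ {i j} → Wd i ≺ Wd j → L i ≤ L j
  ≺⇒L≤ {i} {j} h = subst₂ _≤_ (cong toℕ (Wd-head i)) (cong toℕ (Wd-head j)) (≺⇒first≤ h)

  shift-plus : ∀ {i j} → Wd i ≺ Wd j → s i ≡ s j → σ (s i) ≡ plus → Wd (suc i) ≺ Wd (suc j)
  shift-plus {i} {j} r e p =
    ≺-resp (Wd-tl i) (Wd-tl j) (tl-plus r (trans (Wd-head i) (trans e (sym (Wd-head j)))) (trans (cong σ (Wd-head i)) p))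

  shift-minus : ∀ {i j} → Wd i ≺ Wd j → s i ≡ s j → σ (s i) ≡ minus → Wd (suc j) ≺ Wd (suc i)
  shift-minus {i} {j} r e p =
    ≺-resp (Wd-tl j) (Wd-tl i) (tl-minus r (trans (Wd-head i) (trans e (sym (Wd-head j)))) (trans (cong σ (Wd-head i)) p))

  invariant⇒periodic : (I : ℕ → Set) → (∀ j → I j → I (suc j)) →
                       ∀ d → (∀ j → I j → s j ≡ s (d + j)) → ∀ j0 → I j0 → SameWord (Wd j0) (Wd (d + j0))
  invariant⇒periodic I step d period j0 h0 i = begin
    s (j0 + i)       ≡⟨ cong s (+-comm j0 i) ⟩
    s (i + j0)       ≡⟨ period (i + j0) (from i) ⟩
    s (d + (i + j0)) ≡⟨ cong (λ x → s (d + x)) (+-comm i j0) ⟩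
    s (d + (j0 + i)) ≡⟨ cong s (+-assoc d j0 i) ⟨
    s (d + j0 + i)   ∎
    where
    open ≡-Reasoning
    from : ∀ m → I (m + j0)
    from zero = h0
    from (suc m) = step (m + j0) (from m)

  no-descent-at-min : (a : Fin k) → IsMin a → σ a ≡ plus →
                      ∀ j0 → s j0 ≡ a → ¬ (Wd (suc j0) ≺ Wd j0)
  no-descent-at-min a amin ap j0 h0 r0 =
    ≺-irrefl (λ i → sym (invariant⇒periodic I step 1 (λ j h → trans (proj₁ h) (sym (proj₁ (step j h)))) j0 (h0 , r0) i)) r0
    where
    I : ℕ → Set
    I j = s j ≡ a × Wd (suc j) ≺ Wd j
    step : ∀ j → I j → I (suc j)
    step j (e , r) = e' , shift-plus r (trans e' (sym e)) (trans (cong σ e') ap)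
      where
      e' : s (suc j) ≡ a
      e' = amin _ (subst (L (suc j) ≤_) (cong toℕ e) (≺⇒L≤ r))

  no-ascent-at-max : (a : Fin k) → IsMax a → σ a ≡ plus →
                     ∀ j0 → s j0 ≡ a → ¬ (Wd j0 ≺ Wd (suc j0))
  no-ascent-at-max a amax ap j0 h0 r0 =
    ≺-irrefl (invariant⇒periodic I step 1 (λ j h → trans (proj₁ h) (sym (proj₁ (step j h)))) j0 (h0 , r0)) r0
    where
    I : ℕ → Set
    I j = s j ≡ a × Wd j ≺ Wd (suc j)
    step : ∀ j → I j → I (suc j)
    step j (e , r) = e' , shift-plus r (trans e (sym e')) (trans (cong σ e) ap)
      where
      e' : s (suc j) ≡ a
      e' = amax _ (subst (_≤ L (suc j)) (cong toℕ e) (≺⇒L≤ r))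

  -- If both extreme letters have sign −, the orbit cannot alternate between
  -- them with the order-pattern used in conditions (d) and (e): the
  -- configuration "top, bot, top, ascending" and "bot, top, bot, descending"
  -- reproduce each other after one shift.
  Alternating : Fin k → Fin k → ℕ → Set
  Alternating bot top j =
    (s j ≡ top × s (1 + j) ≡ bot × s (2 + j) ≡ top × Wd j ≺ Wd (2 + j)) ⊎
    (s j ≡ bot × s (1 + j) ≡ top × s (2 + j) ≡ bot × Wd (2 + j) ≺ Wd j)

  no-alternation : (bot top : Fin k) → IsMin bot → IsMax top → σ bot ≡ minus → σ top ≡ minus →
                   ∀ j0 → ¬ Alternating bot top j0
  no-alternation bot top bmin tmax bm tm j0 h0 = contradiction h0
    where
    step : ∀ j → Alternating bot top j → Alternating bot top (suc j)
    step j (inj₁ (e0 , e1 , e2 , r)) = inj₂ (e1 , e2 , e3 , r')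
      where
      r' : Wd (3 + j) ≺ Wd (1 + j)
      r' = shift-minus r (trans e0 (sym e2)) (trans (cong σ e0) tm)
      e3 : s (3 + j) ≡ bot
      e3 = bmin _ (subst (L (3 + j) ≤_) (cong toℕ e1) (≺⇒L≤ r'))
    step j (inj₂ (e0 , e1 , e2 , r)) = inj₁ (e1 , e2 , e3 , r')
      where
      r' : Wd (1 + j) ≺ Wd (3 + j)
      r' = shift-minus r (trans e2 (sym e0)) (trans (cong σ e2) bm)
      e3 : s (3 + j) ≡ top
      e3 = tmax _ (subst (_≤ L (3 + j)) (cong toℕ e1) (≺⇒L≤ r'))
    period : ∀ j → Alternating bot top j → s j ≡ s (2 + j)
    period j (inj₁ (e0 , _ , e2 , _)) = trans e0 (sym e2)
    period j (inj₂ (e0 , _ , e2 , _)) = trans e0 (sym e2)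
    same : SameWord (Wd j0) (Wd (2 + j0))
    same = invariant⇒periodic (Alternating bot top) step 2 period j0 h0
    contradiction : Alternating bot top j0 → ⊥
    contradiction (inj₁ (_ , _ , _ , r)) = ≺-irrefl same r
    contradiction (inj₂ (_ , _ , _ , r)) = ≺-irrefl (λ i → sym (same i)) r

  period-extends : ∀ A b → 1 ≤ b → (∀ r → r < b → s (A + r) ≡ s (A + b + r)) → ∀ j →
                   (∀ i → i < j → s (A + b + i) ≡ s (A + b + b + i)) →
                   ∀ i → i ≤ j → s (A + i) ≡ s (A + b + i)
  period-extends A b 1≤b first j further i i≤j with i <? b
  ... | yes i<b = first i i<b
  ... | no i≮b = begin
      s (A + i)            ≡⟨ cong (λ x → s (A + x)) b+i′ ⟨
      s (A + (b + i′))     ≡⟨ cong s (+-assoc A b i′) ⟨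
      s (A + b + i′)       ≡⟨ further i′ i′<j ⟩
      s (A + b + b + i′)   ≡⟨ cong s (+-assoc (A + b) b i′) ⟩
      s (A + b + (b + i′)) ≡⟨ cong (λ x → s (A + b + x)) b+i′ ⟩
      s (A + b + i)        ∎
    where
    open ≡-Reasoning
    i′ : ℕ
    i′ = i ∸ b
    b+i′ : b + i′ ≡ i
    b+i′ = m+[n∸m]≡n (≮⇒≥ i≮b)
    i′<j : i′ < j
    i′<j = <-≤-trans (subst (i′ <_) b+i′ (+-monoˡ-≤ i′ 1≤b)) i≤j

count : (ℕ → ℕ) → ℕ → ℕ → ℕ
count g t zero = 0
count g t (suc m) with g m <? t
... | yes _ = suc (count g t m)
... | no _ = count g t m

module Count (g : ℕ → ℕ) where

  count≤ : ∀ t m → count g t m ≤ m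
  count≤ t zero = z≤n
  count≤ t (suc m) with g m <? t
  ... | yes _ = s≤s (count≤ t m)
  ... | no _ = m≤n⇒m≤1+n (count≤ t m)

  count-zero : ∀ m → count g 0 m ≡ 0
  count-zero zero = refl
  count-zero (suc m) with g m <? 0
  ... | no _ = count-zero m

  count-all : ∀ t m → (∀ v → v < m → g v < t) → count g t m ≡ m
  count-all t zero h = refl
  count-all t (suc m) h with g m <? t
  ... | yes _ = cong suc (count-all t m (λ v v<m → h v (m<n⇒m<1+n v<m)))
  ... | no ¬p = ⊥-elim (¬p (h m ≤-refl))

  count-extend : ∀ t m d → count g t m ≤ count g t (d + m)
  count-extend t m zero = ≤-refl
  count-extend t m (suc d) with g (d + m) <? t
  ... | yes _ = m≤n⇒m≤1+n (count-extend t m d)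
  ... | no _ = count-extend t m d

  count-mono : ∀ {t t'} m → t ≤ t' → count g t m ≤ count g t' m
  count-mono zero _ = z≤n
  count-mono {t} {t'} (suc m) t≤t' with g m <? t | g m <? t'
  ... | yes _ | yes _ = s≤s (count-mono m t≤t')
  ... | yes p | no ¬q = ⊥-elim (¬q (<-≤-trans p t≤t'))
  ... | no _  | yes _ = m≤n⇒m≤1+n (count-mono m t≤t')
  ... | no _  | no _  = count-mono m t≤t'

  -- For monotone g the values below t form an initial segment, so the count
  -- locates ranks: t ≤ g v gives count ≤ v, and g v < t gives v < count.
  module Monotone (mono : ∀ {v v'} → v ≤ v' → g v ≤ g v') where

    count-frozen : ∀ t v d → t ≤ g v → count g t (d + v) ≡ count g t v
    count-frozen t v zero h = refl
    count-frozen t v (suc d) h with g (d + v) <? t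
    ... | yes p = ⊥-elim (<-irrefl refl (<-≤-trans p (≤-trans h (mono (m≤n+m v d)))))
    ... | no _ = count-frozen t v d h

    count≤rank : ∀ t n v → v ≤ n → t ≤ g v → count g t n ≤ v
    count≤rank t n v v≤n h = begin
      count g t n                 ≡⟨ cong (count g t) (m∸n+n≡m v≤n) ⟨
      count g t ((n ∸ v) + v)     ≡⟨ count-frozen t v (n ∸ v) h ⟩
      count g t v                 ≤⟨ count≤ t v ⟩
      v                           ∎
      where open ≤-Reasoning

    rank<count : ∀ t n v → v < n → g v < t → suc v ≤ count g t n
    rank<count t n v v<n h = begin
      suc v                       ≡⟨ count-all t (suc v) (λ v' v'≤v → ≤-<-trans (mono (s≤s⁻¹ v'≤v)) h) ⟨
      count g t (suc v)           ≤⟨ count-extend t (suc v) (n ∸ suc v) ⟩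
      count g t ((n ∸ suc v) + suc v) ≡⟨ cong (count g t) (m∸n+n≡m v<n) ⟩
      count g t n                 ∎
      where open ≤-Reasoning

module Positions where
  private
    ring₁ : ∀ A b → suc (A + b + b) ≡ suc A + 2 * b
    ring₁ = solve-∀
    ring₂ : ∀ A r d → suc (A + (r + suc d)) ≡ suc (A + r) + suc d
    ring₂ = solve-∀
    ring₃ : ∀ A r d → suc (A + (r + suc d) + (r + suc d)) ≡ suc (A + (r + suc d) + r) + suc d
    ring₃ = solve-∀
    ring₄ : ∀ A b → A + 2 * b ≡ A + b + b
    ring₄ = solve-∀

  n∸2b : ∀ A b → suc (A + b + b) ∸ 2 * b ≡ suc A
  n∸2b A b = trans (cong (_∸ 2 * b) (ring₁ A b)) (m+n∸n≡m (suc A) (2 * b))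

  n∸b : ∀ A b → suc (A + b + b) ∸ b ≡ suc (A + b)
  n∸b A b = m+n∸n≡m (suc (A + b)) b

  -- with b = r + suc d and i = suc d: the positions n-b-i and n-i
  n∸b∸i : ∀ A r d → suc (A + (r + suc d) + (r + suc d)) ∸ (r + suc d) ∸ suc d ≡ suc (A + r)
  n∸b∸i A r d = trans (cong (_∸ suc d) (n∸b A (r + suc d)))
                  (trans (cong (_∸ suc d) (ring₂ A r d)) (m+n∸n≡m (suc (A + r)) (suc d)))

  n∸i : ∀ A r d → suc (A + (r + suc d) + (r + suc d)) ∸ suc d ≡ suc (A + (r + suc d) + r)
  n∸i A r d = trans (cong (_∸ suc d) (ring₃ A r d)) (m+n∸n≡m _ (suc d))

  split : ∀ m b → 1 ≤ suc m ∸ 2 * b → m ≡ (m ∸ 2 * b) + b + b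
  split m b h = sym (trans (sym (ring₄ (m ∸ 2 * b) b)) (m∸n+n≡m 2b≤m))
    where
    2b≤m : 2 * b ≤ m
    2b≤m = ≮⇒≥ λ lt → 1+n≰n (subst (1 ≤_) (m≤n⇒m∸n≡0 lt) h)

onℕ : ∀ {n} → (Fin n → Fin n) → ℕ → ℕ
onℕ {n} f i with i <? n
... | yes p = toℕ (f (fromℕ< p))
... | no _ = 0

module _ {n : ℕ} where

  onℕ-fromℕ< : ∀ (f : Fin n → Fin n) i → (lt : i < n) → onℕ f i ≡ toℕ (f (fromℕ< lt))
  onℕ-fromℕ< f i lt with i <? n
  ... | yes _ = refl
  ... | no ¬lt = ⊥-elim (¬lt lt)

  onℕ-toℕ : ∀ (f : Fin n → Fin n) (I : Fin n) → onℕ f (toℕ I) ≡ toℕ (f I)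
  onℕ-toℕ f I = trans (onℕ-fromℕ< f (toℕ I) (toℕ<n I)) (cong (λ x → toℕ (f x)) (fromℕ<-toℕ I (toℕ<n I)))

  onℕ<n : ∀ (f : Fin n → Fin n) i → i < n → onℕ f i < n
  onℕ<n f i lt = subst (_< n) (sym (onℕ-fromℕ< f i lt)) (toℕ<n _)

  onℕ-inverse : (f g : Fin n → Fin n) → (∀ x → g (f x) ≡ x) → ∀ i → i < n → onℕ g (onℕ f i) ≡ i
  onℕ-inverse f g gf i lt = begin
    onℕ g (onℕ f i)                ≡⟨ cong (onℕ g) (onℕ-fromℕ< f i lt) ⟩
    onℕ g (toℕ (f (fromℕ< lt)))    ≡⟨ onℕ-toℕ g (f (fromℕ< lt)) ⟩
    toℕ (g (f (fromℕ< lt)))        ≡⟨ cong toℕ (gf (fromℕ< lt)) ⟩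
    toℕ (fromℕ< lt)                ≡⟨ toℕ-fromℕ< lt ⟩
    i                              ∎
    where open ≡-Reasoning

nextFin-value : ∀ {m} (I : Fin (suc m)) → toℕ (nextFin I) ≡ suc (toℕ I) % suc m
nextFin-value I = toℕ-fromℕ< _

nextFin-wrap : ∀ {m} (I : Fin (suc m)) → toℕ (nextFin I) ≡ 0 → toℕ I ≡ m
nextFin-wrap {m} I h with toℕ I <? m
... | yes lt = ⊥-elim (0≢1+n (trans (sym h) (trans (nextFin-value I) (m<n⇒m%n≡m (s≤s lt)))))
... | no ¬lt = ≤-antisym (s≤s⁻¹ (toℕ<n I)) (≮⇒≥ ¬lt)

nextFin-step : ∀ {m} (I : Fin (suc m)) → ¬ (toℕ (nextFin I) ≡ 0) →
               toℕ I < m × toℕ (nextFin I) ≡ suc (toℕ I)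
nextFin-step {m} I h with toℕ I <? m
... | yes lt = lt , trans (nextFin-value I) (m<n⇒m%n≡m (s≤s lt))
... | no ¬lt = ⊥-elim (h (trans (nextFin-value I) (trans (cong (λ x → suc x % suc m) last) (n%n≡0 (suc m)))))
  where
  last : toℕ I ≡ m
  last = ≤-antisym (s≤s⁻¹ (toℕ<n I)) (≮⇒≥ ¬lt)

-- 0-indexed one-line notation P of a permutation π of length n = suc m and
-- its inverse Q, and the decoding of π̂* in terms of P.
module Ranks {m : ℕ} (π : Permutation′ (suc m)) where

  P Q : ℕ → ℕ
  P = onℕ (π ⟨$⟩ʳ_)
  Q = onℕ (π ⟨$⟩ˡ_)

  P<n : ∀ i → i < suc m → P i < suc m
  P<n = onℕ<n (π ⟨$⟩ʳ_)

  Q<n : ∀ i → i < suc m → Q i < suc m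
  Q<n = onℕ<n (π ⟨$⟩ˡ_)

  QP : ∀ i → i < suc m → Q (P i) ≡ i
  QP = onℕ-inverse (π ⟨$⟩ʳ_) (π ⟨$⟩ˡ_) (λ _ → inverseˡ π)

  PQ : ∀ i → i < suc m → P (Q i) ≡ i
  PQ = onℕ-inverse (π ⟨$⟩ˡ_) (π ⟨$⟩ʳ_) (λ _ → inverseʳ π)

  P-injective : ∀ {i j} → i < suc m → j < suc m → P i ≡ P j → i ≡ j
  P-injective {i} {j} li lj e = trans (sym (QP i li)) (trans (cong Q e) (QP j lj))

  piN-suc : ∀ i → i < suc m → piN π (suc i) ≡ suc (P i)
  piN-suc i lt with i <? suc m
  ... | yes _ = refl
  ... | no ¬lt = ⊥-elim (¬lt lt)

  star-position : ∀ p → p < suc m → hatStar π (suc p) ≡ nothing → P m ≡ p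
  star-position p lt h with p <? suc m
  ... | no ¬lt = ⊥-elim (¬lt lt)
  ... | yes lt' with toℕ (nextFin (π ⟨$⟩ˡ fromℕ< lt')) ≟ 0
  ...   | yes wraps = begin
          P m                            ≡⟨ cong P (nextFin-wrap I wraps) ⟨
          P (toℕ I)                      ≡⟨ onℕ-toℕ (π ⟨$⟩ʳ_) I ⟩
          toℕ (π ⟨$⟩ʳ (π ⟨$⟩ˡ fromℕ< lt')) ≡⟨ cong toℕ (inverseʳ π) ⟩
          toℕ (fromℕ< lt')               ≡⟨ toℕ-fromℕ< lt' ⟩
          p                              ∎
    where
    open ≡-Reasoning
    I : Fin (suc m)
    I = π ⟨$⟩ˡ fromℕ< lt'
  star-position p lt () | yes lt' | no _

  hat-entry : ∀ q a → hatStar π q ≡ just a →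
              Σ ℕ λ i → i < m × suc (P i) ≡ q × a ≡ suc (P (suc i))
  hat-entry zero a ()
  hat-entry (suc p) a h with p <? suc m
  hat-entry (suc p) a () | no _
  ... | yes lt with toℕ (nextFin (π ⟨$⟩ˡ fromℕ< lt)) ≟ 0
  hat-entry (suc p) a () | yes lt | yes _
  hat-entry (suc p) a refl | yes lt | no nowrap =
      toℕ I , proj₁ step , cong suc position , cong suc value
    where
    I : Fin (suc m)
    I = π ⟨$⟩ˡ fromℕ< lt
    step : toℕ I < m × toℕ (nextFin I) ≡ suc (toℕ I)
    step = nextFin-step I nowrap
    position : P (toℕ I) ≡ p
    position = trans (onℕ-toℕ (π ⟨$⟩ʳ_) I) (trans (cong toℕ (inverseʳ π)) (toℕ-fromℕ< lt))
    value : toℕ (π ⟨$⟩ʳ nextFin I) ≡ P (suc (toℕ I))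
    value = trans (sym (onℕ-toℕ (π ⟨$⟩ʳ_) (nextFin I))) (cong P (proj₂ step))

module Pattern (k : ℕ) (σ : Fin k → Sign) (m : ℕ) (π : Permutation′ (suc m))
               (s : Word k) (realises : IsPattern σ s π) where
  open Order σ
  open Orbit σ s
  open Ranks π

  n : ℕ
  n = suc m

  rank<⇒≺ : ∀ {i j} → i < n → j < n → P i < P j → Wd i ≺ Wd j
  rank<⇒≺ {i} {j} li lj h =
    subst₂ (λ a b → Wd a ≺ Wd b) (toℕ-fromℕ< li) (toℕ-fromℕ< lj)
      (Equivalence.to (proj₂ realises (fromℕ< li) (fromℕ< lj))
        (subst₂ _<_ (onℕ-fromℕ< (π ⟨$⟩ʳ_) i li) (onℕ-fromℕ< (π ⟨$⟩ʳ_) j lj) h))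

  ≺⇒rank< : ∀ {i j} → i < n → j < n → Wd i ≺ Wd j → P i < P j
  ≺⇒rank< {i} {j} li lj h =
    subst₂ _<_ (sym (onℕ-fromℕ< (π ⟨$⟩ʳ_) i li)) (sym (onℕ-fromℕ< (π ⟨$⟩ʳ_) j lj))
      (Equivalence.from (proj₂ realises (fromℕ< li) (fromℕ< lj))
        (subst₂ (λ a b → Wd a ≺ Wd b) (sym (toℕ-fromℕ< li)) (sym (toℕ-fromℕ< lj)) h))

  -- The letter profile: g v is the first letter of the orbit word of rank v
  -- (and k beyond the last rank).  Since ≺ compares first letters first,
  -- g is monotone.
  g : ℕ → ℕ
  g v with v <? n
  ... | yes lt = L (toℕ (π ⟨$⟩ˡ fromℕ< lt))
  ... | no _ = k

  g-rank : ∀ v → v < n → g v ≡ L (Q v)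
  g-rank v lt with v <? n
  ... | yes _ = refl
  ... | no ¬lt = ⊥-elim (¬lt lt)

  g-P : ∀ i → i < n → g (P i) ≡ L i
  g-P i lt = trans (g-rank (P i) (P<n i lt)) (cong L (QP i lt))

  g-beyond : ∀ v → ¬ (v < n) → g v ≡ k
  g-beyond v ¬lt with v <? n
  ... | yes lt = ⊥-elim (¬lt lt)
  ... | no _ = refl

  g≤k : ∀ v → g v ≤ k
  g≤k v with v <? n
  ... | yes _ = <⇒≤ (toℕ<n _)
  ... | no _ = ≤-refl

  g<k : ∀ v → v < n → g v < k
  g<k v lt = subst (_< k) (sym (g-rank v lt)) (toℕ<n _)

  g-mono : ∀ {v v'} → v ≤ v' → g v ≤ g v'
  g-mono {v} {v'} le = by-cases (v' <? n)
    where
    by-cases : Dec (v' < n) → g v ≤ g v'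
    by-cases (no ¬lt') = subst (g v ≤_) (sym (g-beyond v' ¬lt')) (g≤k v)
    by-cases (yes lt') = subst₂ _≤_ (sym (g-rank v lt)) (sym (g-rank v' lt')) (≮⇒≥ inverted)
      where
      lt : v < n
      lt = ≤-<-trans le lt'
      inverted : ¬ (L (Q v') < L (Q v))
      inverted h = <⇒≱ (subst₂ _<_ (PQ v' lt') (PQ v lt)
                     (≺⇒rank< (Q<n v' lt') (Q<n v lt) (L<⇒≺ _ _ h))) le

  open Count g
  open Monotone g-mono

  e : ℕ → ℕ
  e t = count g t n

  inBlock⇒letter : ∀ t v → v < n → InBlock e t (suc v) → g v ≡ t
  inBlock⇒letter t v lt (above , below) = ≤-antisym (s≤s⁻¹ g<t+1) t≤g
    where
    t≤g : t ≤ g v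
    t≤g = ≮⇒≥ (λ h → <-irrefl refl (<-≤-trans above (rank<count t n v lt h)))
    g<t+1 : g v < suc t
    g<t+1 = ≰⇒> (λ h → <-irrefl refl (≤-<-trans (count≤rank (suc t) n v (<⇒≤ lt) h) below))

  letter⇒inBlock : ∀ t v → v < n → g v ≡ t → InBlock e t (suc v)
  letter⇒inBlock t v lt h = s≤s (count≤rank t n v (<⇒≤ lt) (≤-reflexive (sym h))) ,
                            rank<count (suc t) n v lt (s≤s (≤-reflexive h))

  inBlock⇒s : ∀ i (t : Fin k) → i < n → InBlock e (toℕ t) (suc (P i)) → s i ≡ t
  inBlock⇒s i t lt h = toℕ-injective (trans (sym (g-P i lt)) (inBlock⇒letter (toℕ t) (P i) (P<n i lt) h))

  s⇒inBlock : ∀ i (t : Fin k) → i < n → s i ≡ t → InBlock e (toℕ t) (suc (P i))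
  s⇒inBlock i t lt h = letter⇒inBlock (toℕ t) (P i) (P<n i lt) (trans (g-P i lt) (cong toℕ h))

  block-end≤ : ∀ t i → i < n → t ≤ L i → e t ≤ P i
  block-end≤ t i lt h = count≤rank t n (P i) (<⇒≤ (P<n i lt)) (subst (t ≤_) (sym (g-P i lt)) h)

  block-end≥ : ∀ t i → i < n → L i < t → suc (P i) ≤ e t
  block-end≥ t i lt h = rank<count t n (P i) (P<n i lt) (subst (_< t) (sym (g-P i lt)) h)

  inner : ∀ {i} → i < m → i < n
  inner = m<n⇒m<1+n

  next-is-last : ∀ {i} → i < m → P (suc i) ≡ P m → suc i ≡ m
  next-is-last i<m = P-injective (s≤s i<m) ≤-refl

  -- (a) Entries π_{i+1} < π_{i'+1} of π̂* in block t sit at positions π_i, π_{i'}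
  -- with s_i = s_{i'} = t; dropping this common first letter keeps the order
  -- of Σ^i s, Σ^{i'} s if σ_t = + and reverses it if σ_t = −.
  monotone-blocks : ∀ (t : Fin k) (p q a b : ℕ) → e (toℕ t) < p → p < q → q ≤ e (suc (toℕ t)) →
                    hatStar π p ≡ just a → hatStar π q ≡ just b →
                    (σ t ≡ plus → a < b) × (σ t ≡ minus → b < a)
  monotone-blocks t p q a b above p<q below hp hq with hat-entry p a hp | hat-entry q b hq
  ... | i , i<m , refl , refl | i' , i'<m , refl , refl = increasing , decreasing
    where
    si : s i ≡ t
    si = inBlock⇒s i t (inner i<m) (above , ≤-trans (<⇒≤ p<q) below)
    same : s i ≡ s i'
    same = trans si (sym (inBlock⇒s i' t (inner i'<m) (<-trans above p<q , below)))
    r : Wd i ≺ Wd i'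
    r = rank<⇒≺ (inner i<m) (inner i'<m) (s≤s⁻¹ p<q)
    increasing : σ t ≡ plus → suc (P (suc i)) < suc (P (suc i'))
    increasing p = s≤s (≺⇒rank< (s≤s i<m) (s≤s i'<m) (shift-plus r same (trans (cong σ si) p)))
    decreasing : σ t ≡ minus → suc (P (suc i')) < suc (P (suc i))
    decreasing p = s≤s (≺⇒rank< (s≤s i'<m) (s≤s i<m) (shift-minus r same (trans (cong σ si) p)))

  -- (b) π̂* = *1⋯ means π_n = 1 and π_{n-1} = 2 (position i = n-2, 0-indexed).
  -- If s_i were the letter 0 of sign +, Σ^{n-1}s ≺ Σ^{n-2}s would give a
  -- descent of the orbit at 0; hence s_i ≥ 1 and block 0 ends by 1.
  condB : ∀ (t0 : Fin k) → toℕ t0 ≡ 0 → σ t0 ≡ plus →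
          hatStar π 1 ≡ nothing → hatStar π 2 ≡ just 1 → e 1 ≤ 1
  condB t0 z plus0 star h with hat-entry 2 1 h
  ... | i , i<m , Pi , ea = subst (e 1 ≤_) (suc-injective Pi) (block-end≤ 1 i (inner i<m) (n≢0⇒n>0 letter≢0))
    where
    Pm : P m ≡ 0
    Pm = star-position 0 z<s star
    last : suc i ≡ m
    last = next-is-last i<m (trans (suc-injective (sym ea)) (sym Pm))
    letter≢0 : L i ≢ 0
    letter≢0 L0 = no-descent-at-min t0 (zero-isMin t0 z) plus0 m sm descent
      where
      si : s i ≡ t0
      si = toℕ-injective (trans L0 (sym z))
      r : Wd m ≺ Wd i
      r = rank<⇒≺ ≤-refl (inner i<m) (subst₂ _<_ (sym Pm) (sym (suc-injective Pi)) z<s)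
      sm : s m ≡ t0
      sm = zero-isMin t0 z (s m) (subst (L m ≤_) (trans L0 (sym z)) (≺⇒L≤ r))
      descent : Wd (suc m) ≺ Wd m
      descent = subst (λ j → Wd (suc m) ≺ Wd j) last (shift-plus r (trans sm (sym si)) (trans (cong σ sm) plus0))

  -- (c) Dually, π̂* = ⋯n* means π_n = n and π_{n-1} = n-1; if s_{n-2} were the
  -- top letter of sign +, the orbit would ascend at the top.
  condC : ∀ (tl : Fin k) → suc (toℕ tl) ≡ k → σ tl ≡ plus →
          hatStar π (n ∸ 1) ≡ just n → hatStar π n ≡ nothing → n ∸ 1 ≤ e (k ∸ 1)
  condC tl z plusTop h star with hat-entry m n h
  ... | i , i<m , Pi , ea =
      subst (_≤ e (k ∸ 1)) Pi (block-end≥ (k ∸ 1) i (inner i<m) (subst (L i <_) (cong (_∸ 1) z) letter<top))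
    where
    Pm : P m ≡ m
    Pm = star-position m ≤-refl star
    last : suc i ≡ m
    last = next-is-last i<m (trans (suc-injective (sym ea)) (sym Pm))
    r : Wd i ≺ Wd m
    r = rank<⇒≺ (inner i<m) ≤-refl (≤-reflexive (trans Pi (sym Pm)))
    letter<top : L i < toℕ tl
    letter<top = ≰⇒> λ top≤ → no-ascent-at-max tl (last-isMax tl z) plusTop m (sm top≤) (ascent top≤)
      where
      si : toℕ tl ≤ L i → s i ≡ tl
      si top≤ = last-isMax tl z (s i) top≤
      sm : toℕ tl ≤ L i → s m ≡ tl
      sm top≤ = last-isMax tl z (s m) (≤-trans top≤ (≺⇒L≤ r))
      ascent : toℕ tl ≤ L i → Wd m ≺ Wd (suc m)
      ascent top≤ = subst (λ j → Wd j ≺ Wd (suc m)) last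
        (shift-plus r (trans (si top≤) (sym (sm top≤))) (trans (cong σ (si top≤)) plusTop))

  -- (d) π̂* = n⋯1* means π_n = n, π_{n-2} = 1, π_{n-1} = n-1.  Unless the first
  -- block is empty (s_{n-2} ≠ 0) or block k-1 starts late (s_{n-3} < k-1), the
  -- letters top, bot, top at n-3, n-2, n-1 alternate, which is impossible when
  -- both extreme letters have sign −.
  condD : ∀ (t0 tl : Fin k) → toℕ t0 ≡ 0 → suc (toℕ tl) ≡ k →
          σ t0 ≡ minus → σ tl ≡ minus →
          hatStar π 1 ≡ just n → hatStar π (n ∸ 1) ≡ just 1 → hatStar π n ≡ nothing →
          e 1 ≡ 0 ⊎ n ∸ 1 ≤ e (k ∸ 1)
  condD t0 tl z0 zk minus0 minusTop h1 h2 star with hat-entry 1 n h1 | hat-entry m 1 h2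
  ... | i0 , i0<m , Pi0 , ea0 | i1 , i1<m , Pi1 , ea1 = by-cases (L i0 ≟ 0) (L i1 <? toℕ tl)
    where
    Pm : P m ≡ m
    Pm = star-position m ≤-refl star
    last : suc i0 ≡ m
    last = next-is-last i0<m (trans (suc-injective (sym ea0)) (sym Pm))
    before : suc i1 ≡ i0
    before = P-injective (s≤s i1<m) (inner i0<m) (trans (suc-injective (sym ea1)) (sym (suc-injective Pi0)))
    by-cases : Dec (L i0 ≡ 0) → Dec (L i1 < toℕ tl) → e 1 ≡ 0 ⊎ m ≤ e (k ∸ 1)
    by-cases (no L≢0) _ =
      inj₁ (n≤0⇒n≡0 (subst (e 1 ≤_) (suc-injective Pi0) (block-end≤ 1 i0 (inner i0<m) (n≢0⇒n>0 L≢0))))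
    by-cases (yes _) (yes below) =
      inj₂ (subst (_≤ e (k ∸ 1)) Pi1 (block-end≥ (k ∸ 1) i1 (inner i1<m) (subst (L i1 <_) (cong (_∸ 1) zk) below)))
    by-cases (yes L0) (no ¬below) = ⊥-elim (no-alternation t0 tl (zero-isMin t0 z0) (last-isMax tl zk)
                                       minus0 minusTop i1 (inj₁ (s1 , s2 , s3 , r')))
      where
      two : 2 + i1 ≡ m
      two = trans (cong suc before) last
      r : Wd i1 ≺ Wd m
      r = rank<⇒≺ (inner i1<m) ≤-refl (≤-reflexive (trans Pi1 (sym Pm)))
      s1 : s i1 ≡ tl
      s1 = last-isMax tl zk (s i1) (≮⇒≥ ¬below)
      s2 : s (1 + i1) ≡ t0
      s2 = subst (λ j → s j ≡ t0) (sym before) (toℕ-injective (trans L0 (sym z0)))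
      s3 : s (2 + i1) ≡ tl
      s3 = subst (λ j → s j ≡ tl) (sym two) (last-isMax tl zk (s m) (≤-trans (≮⇒≥ ¬below) (≺⇒L≤ r)))
      r' : Wd i1 ≺ Wd (2 + i1)
      r' = subst (λ j → Wd i1 ≺ Wd j) (sym two) r

  -- (e) π̂* = *n⋯1 means π_n = 1, π_{n-1} = n, π_{n-2} = 2: the mirror image of (d).
  condE : ∀ (t0 tl : Fin k) → toℕ t0 ≡ 0 → suc (toℕ tl) ≡ k →
          σ t0 ≡ minus → σ tl ≡ minus →
          hatStar π n ≡ just 1 → hatStar π 1 ≡ nothing → hatStar π 2 ≡ just n →
          e (k ∸ 1) ≡ n ⊎ e 1 ≤ 1
  condE t0 tl z0 zk minus0 minusTop h1 star h2 with hat-entry n 1 h1 | hat-entry 2 n h2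
  ... | i1 , i1<m , Pi1 , ea1 | i0 , i0<m , Pi0 , ea0 = by-cases (L i1 <? toℕ tl) (L i0 ≟ 0)
    where
    Pm : P m ≡ 0
    Pm = star-position 0 z<s star
    last : suc i1 ≡ m
    last = next-is-last i1<m (trans (suc-injective (sym ea1)) (sym Pm))
    before : suc i0 ≡ i1
    before = P-injective (s≤s i0<m) (inner i1<m) (trans (suc-injective (sym ea0)) (sym (suc-injective Pi1)))
    by-cases : Dec (L i1 < toℕ tl) → Dec (L i0 ≡ 0) → e (k ∸ 1) ≡ n ⊎ e 1 ≤ 1
    by-cases (yes below) _ = inj₁ (≤-antisym (count≤ (k ∸ 1) n)
      (subst (_≤ e (k ∸ 1)) Pi1 (block-end≥ (k ∸ 1) i1 (inner i1<m) (subst (L i1 <_) (cong (_∸ 1) zk) below))))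
    by-cases (no _) (no L≢0) =
      inj₂ (subst (e 1 ≤_) (suc-injective Pi0) (block-end≤ 1 i0 (inner i0<m) (n≢0⇒n>0 L≢0)))
    by-cases (no ¬below) (yes L0) = ⊥-elim (no-alternation t0 tl (zero-isMin t0 z0) (last-isMax tl zk)
                                       minus0 minusTop i0 (inj₂ (s0 , s1 , s2 , r')))
      where
      two : 2 + i0 ≡ m
      two = trans (cong suc before) last
      r : Wd m ≺ Wd i0
      r = rank<⇒≺ ≤-refl (inner i0<m) (subst₂ _<_ (sym Pm) (sym (suc-injective Pi0)) z<s)
      s0 : s i0 ≡ t0
      s0 = toℕ-injective (trans L0 (sym z0))
      s1 : s (1 + i0) ≡ tl
      s1 = subst (λ j → s j ≡ tl) (sym before) (last-isMax tl zk (s i1) (≮⇒≥ ¬below))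
      s2 : s (2 + i0) ≡ t0
      s2 = subst (λ j → s j ≡ t0) (sym two) (zero-isMin t0 z0 (s m) (subst (L m ≤_) (trans L0 (sym z0)) (≺⇒L≤ r)))
      r' : Wd (2 + i0) ≺ Wd i0
      r' = subst (λ j → Wd j ≺ Wd i0) (sym two) r

  segmentation : IsSegmentation σ n (hatStar π) e
  segmentation = record
    { start  = count-zero n
    ; end    = count-all k n g<k
    ; mono   = λ t _ → count-mono n (n≤1+n t)
    ; blocks = monotone-blocks
    ; condB  = condB
    ; condC  = condC
    ; condD  = condD
    ; condE  = condE
    }

  BadShape : ℕ → Set
  BadShape b = Is312 (piN π (n ∸ 2 * b)) (piN π (n ∸ b)) (piN π n) ⊎
               Is132 (piN π (n ∸ 2 * b)) (piN π (n ∸ b)) (piN π n)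

  SameBlocks : ℕ → Set
  SameBlocks b = ∀ i → 1 ≤ i → i ≤ b → ∀ (t : Fin k) →
    InBlock e (toℕ t) (piN π (n ∸ b ∸ i)) ⇔ InBlock e (toℕ t) (piN π (n ∸ i))

  -- Write m = A + b + b.  As blocks record first letters, the block condition
  -- for i = b - r says s_{A+r} = s_{A+b+r}.
  sameBlocks⇒sameLetter : ∀ A b r d → r + suc d ≡ b → m ≡ A + b + b → SameBlocks b →
                          s (A + r) ≡ s (A + b + r)
  sameBlocks⇒sameLetter A .(r + suc d) r d refl eqm blocks =
    sym (inBlock⇒s (A + b + r) (s (A + r)) lt₂ (subst (InBlock e (L (A + r))) late moved))
    where
    b : ℕ
    b = r + suc d
    lt₂ : A + b + r < n
    lt₂ = s≤s (subst (A + b + r ≤_) (sym eqm) (+-monoʳ-≤ (A + b) (m≤m+n r (suc d))))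
    lt₁ : A + r < n
    lt₁ = ≤-<-trans (+-monoˡ-≤ r (m≤m+n A b)) lt₂
    early : piN π (n ∸ b ∸ suc d) ≡ suc (P (A + r))
    early = trans (cong (λ x → piN π (suc x ∸ b ∸ suc d)) eqm)
              (trans (cong (piN π) (Positions.n∸b∸i A r d)) (piN-suc (A + r) lt₁))
    late : piN π (n ∸ suc d) ≡ suc (P (A + b + r))
    late = trans (cong (λ x → piN π (suc x ∸ suc d)) eqm)
             (trans (cong (piN π) (Positions.n∸i A r d)) (piN-suc (A + b + r) lt₂))
    moved : InBlock e (L (A + r)) (piN π (n ∸ suc d))
    moved = Equivalence.to (blocks (suc d) (s≤s z≤n) (m≤n+m (suc d) r) (s (A + r)))
              (subst (InBlock e (L (A + r))) (sym early) (s⇒inBlock (A + r) (s (A + r)) lt₁ refl))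

  -- No b as in (†) exists: the letters of Σ^A s repeat those of Σ^{A+b} s as
  -- long as Σ^{A+b} s and Σ^{A+2b} s agree, so Σ^A s compares with Σ^{A+2b} s
  -- as Σ^{A+b} s does; this contradicts both 312 and 132.
  no-bad-period : ¬ (Σ ℕ λ b → 1 ≤ b × 1 ≤ n ∸ 2 * b × BadShape b × SameBlocks b)
  no-bad-period (b , 1≤b , room , shape , blocks) = impossible shape
    where
    A : ℕ
    A = m ∸ 2 * b
    eqm : m ≡ A + b + b
    eqm = Positions.split m b room
    ltC : A + b + b < n
    ltC = subst (_< n) eqm ≤-refl
    ltB : A + b < n
    ltB = ≤-<-trans (m≤m+n (A + b) b) ltC
    ltA : A < n
    ltA = ≤-<-trans (m≤m+n A b) ltB
    pA : piN π (n ∸ 2 * b) ≡ suc (P A)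
    pA = trans (cong (λ x → piN π (suc x ∸ 2 * b)) eqm) (trans (cong (piN π) (Positions.n∸2b A b)) (piN-suc A ltA))
    pB : piN π (n ∸ b) ≡ suc (P (A + b))
    pB = trans (cong (λ x → piN π (suc x ∸ b)) eqm) (trans (cong (piN π) (Positions.n∸b A b)) (piN-suc (A + b) ltB))
    pC : piN π n ≡ suc (P (A + b + b))
    pC = trans (cong (λ x → piN π (suc x)) eqm) (piN-suc (A + b + b) ltC)
    period : ∀ r → r < b → s (A + r) ≡ s (A + b + r)
    period r r<b = sameBlocks⇒sameLetter A b r (b ∸ suc r) (trans (+-suc r _) (m+[n∸m]≡n r<b)) eqm blocks
    impossible : BadShape b → ⊥
    impossible (inj₁ (y<z , z<x)) = <-asym (≺⇒rank< ltA ltC (≺-transferˡ o agree)) (s≤s⁻¹ (subst₂ _<_ pC pA z<x))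
      where
      o : Wd (A + b) ≺ Wd (A + b + b)
      o = rank<⇒≺ ltB ltC (s≤s⁻¹ (subst₂ _<_ pB pC y<z))
      agree : ∀ i → i ≤ proj₁ o → s (A + i) ≡ s (A + b + i)
      agree = period-extends A b 1≤b period (proj₁ o) (proj₁ (proj₂ o))
    impossible (inj₂ (x<z , z<y)) = <-asym (≺⇒rank< ltC ltA (≺-transferʳ o agree)) (s≤s⁻¹ (subst₂ _<_ pA pC x<z))
      where
      o : Wd (A + b + b) ≺ Wd (A + b)
      o = rank<⇒≺ ltC ltB (s≤s⁻¹ (subst₂ _<_ pC pB z<y))
      agree : ∀ i → i ≤ proj₁ o → s (A + i) ≡ s (A + b + i)
      agree = period-extends A b 1≤b period (proj₁ o) (λ i i<j → sym (proj₁ (proj₂ o) i i<j))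

lemma2p3 : (k : ℕ) → 2 ≤ k → (σ : Fin k → Sign) → (n : ℕ) → 1 ≤ n →
    (π : Permutation′ n) → Allowed σ π → Dagger σ π
lemma2p3 k _ σ (suc m) _ π (s , realises) = e , segmentation , no-bad-period
  where open Pattern k σ m π s realises
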